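{- Let $g \geq 2$ be an integer. Let $n$ and $s_1, \dots, s_v$ be positive integers such that $s_g(n) = s_1 + \cdots + s_v$ and $s_v > (g-2)(v-1)$. Then there exist positive integers $n_1, \dots, n_v$ such that $[n]_g = [n_1]_g \mid \cdots \mid [n_v]_g$ and $|s_g(n_i) - s_i| \leq (g-2)(v-1)$ for $i = 1, \dots, v$.
   Context: For a positive integer $n$, write uniquely $n = \sum_{i=1}^{\ell} d_i g^{i-1}$ with $d_1,\dots,d_\ell \in \{0,\dots,g-1\}$ and $d_\ell \neq 0$. Then $[n]_g$ denotes the string $d_1, \dots, d_\ell$ (least significant digit first), $s_g(n) := \sum_{i=1}^\ell d_i$ is the base-$g$ sum of digits, and $\ell_g(n) := \ell$. For strings $a, b$, $a \mid b$ denotes their concatenation. -}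

module Defs where

open import Data.Nat using (ℕ; zero; suc; NonZero)
open import Data.Nat.DivMod using (_%_; _/_)
open import Data.List using (List; []; _∷_)
open import Data.Nat.ListAction using (sum)

-- Base-g digits, least significant first, with fuel.
-- For g ≥ 2, fuel n suffices (each step strictly decreases a positive number).
digitsAux : (g : ℕ) → .{{NonZero g}} → ℕ → ℕ → List ℕ
digitsAux g zero    n       = []
digitsAux g (suc f) zero    = []
digitsAux g (suc f) (suc m) = (suc m % g) ∷ digitsAux g f (suc m / g)

digits : (g : ℕ) → .{{NonZero g}} → ℕ → List ℕ
digits g n = digitsAux g n n

digitSum : (g : ℕ) → .{{NonZero g}} → ℕ → ℕ
digitSum g n = sum (digits g n)

-- Cut [n]_g greedily from the least significant end: the i-th piece is the
-- shortest prefix of what remains whose digit sum reaches s_i. The piece ends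
-- with the digit that made its sum reach s_i, which is nonzero, so it is
-- [n_i]_g for some n_i; and since the sum before that digit was below s_i and
-- the digit is at most g - 1, the piece overshoots s_i by at most g - 2. The
-- overshoots of the first v - 1 pieces add up to a deficit of at most
-- (g - 2)(v - 1), which the remaining string (the last piece) absorbs;
-- s_v > (g - 2)(v - 1) guarantees that enough digit sum is always left for
-- the next cut.
module Submission where

open import Defs
open import Data.Nat using (ℕ; zero; suc; _+_; _*_; _∸_; _≤_; _<_; z≤n; s≤s; s≤s⁻¹; _≤?_; NonZero; >-nonZero; ∣_-_∣)
open import Data.Nat.Properties
open import Data.Nat.DivMod
open import Data.Nat.Divisibility using (n∣m*n)
open import Data.Nat.ListAction using () renaming (sum to sumᴸ)
open import Data.Nat.ListAction.Properties using (sum-++)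
open import Data.Nat.Tactic.RingSolver using (solve-∀)
open import Data.List using (List; []; _∷_; _++_; [_]; length; concat)
open import Data.List.Properties using (++-identityʳ)
open import Data.Vec using (Vec; []; _∷_; lookup; last; toList; map; sum)
open import Data.Vec.Properties using (lookup-map)
open import Data.Vec.Relation.Unary.All as All using (All; []; _∷_)
open import Data.Vec.Relation.Unary.All.Properties using (map⁺; lookup⁺)
open import Data.Fin using (Fin; zero; suc)
open import Data.Product using (Σ; _×_; _,_)
open import Data.Empty using (⊥-elim)
open import Relation.Nullary using (yes; no)
open import Relation.Binary.PropositionalEquality
  using (_≡_; refl; sym; trans; cong; cong₂; subst; module ≡-Reasoning)

last≤sum : ∀ {k} (s : Vec ℕ (suc k)) → last s ≤ sum s
last≤sum (x ∷ [])    = m≤m+n x 0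
last≤sum (x ∷ y ∷ s) = ≤-trans (last≤sum (y ∷ s)) (m≤n+m _ x)

digit≤pos+[g∸2] : ∀ {g d t} → d < g → 1 ≤ t → d ≤ t + (g ∸ 2)
digit≤pos+[g∸2] {suc zero}    (s≤s z≤n) _   = z≤n
digit≤pos+[g∸2] {suc (suc h)} (s≤s d≤h) 1≤t = ≤-trans d≤h (+-monoˡ-≤ h 1≤t)

m+[n+[o+p]]≡m+p+n+o : ∀ m n o p → m + (n + (o + p)) ≡ m + p + n + o
m+[n+[o+p]]≡m+p+n+o = solve-∀

o≤n⇒m+o+n*k≤m+n*[1+k] : ∀ c {o x} k → o ≤ x → c + o + x * k ≤ c + x * suc k
o≤n⇒m+o+n*k≤m+n*[1+k] c {o} {x} k o≤x = begin
  c + o + x * k    ≤⟨ +-monoˡ-≤ (x * k) (+-monoʳ-≤ c o≤x) ⟩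
  c + x + x * k    ≡⟨ +-assoc c x (x * k) ⟩
  c + (x + x * k)  ≡⟨ cong (c +_) (sym (*-suc x k)) ⟩
  c + x * suc k    ∎
  where open ≤-Reasoning

module _ (g : ℕ) .{{_ : NonZero g}} where

  data IsDigitString : List ℕ → Set where
    msd : ∀ {d}    → d < g → 1 ≤ d → IsDigitString [ d ]
    _∷_ : ∀ {d ds} → d < g → IsDigitString ds → IsDigitString (d ∷ ds)

  fromDigits : List ℕ → ℕ
  fromDigits []       = 0
  fromDigits (d ∷ ds) = d + fromDigits ds * g

  fromDigits-positive : ∀ {ds} → IsDigitString ds → 1 ≤ fromDigits ds
  fromDigits-positive (msd _ 1≤d) = ≤-trans 1≤d (m≤m+n _ 0)
  fromDigits-positive (_ ∷ p)     =
    ≤-trans (≤-trans (fromDigits-positive p) (m≤m*n _ g)) (m≤n+m _ _)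

  digitsAux-zero : ∀ f → digitsAux g f 0 ≡ []
  digitsAux-zero zero    = refl
  digitsAux-zero (suc f) = refl

  digitsAux-fromDigits-∷ : ∀ {d} ds f → d < g → 1 ≤ fromDigits (d ∷ ds) →
                           digitsAux g (suc f) (fromDigits (d ∷ ds)) ≡ d ∷ digitsAux g f (fromDigits ds)
  digitsAux-fromDigits-∷ {d} ds f d<g 1≤n with d + fromDigits ds * g in n≡
  ... | suc _ = cong₂ _∷_
    (trans (cong (_% g) (sym n≡)) (trans ([m+kn]%n≡m%n d m g) (m<n⇒m%n≡m d<g)))
    (cong (digitsAux g f) (trans (cong (_/ g) (sym n≡))
      (trans (+-distrib-/-∣ʳ d (n∣m*n m)) (cong₂ _+_ (m<n⇒m/n≡0 d<g) (m*n/n≡m m g)))))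
    where
    m : ℕ
    m = fromDigits ds

  digitsAux-fromDigits : ∀ {ds} f → IsDigitString ds → length ds ≤ f → digitsAux g f (fromDigits ds) ≡ ds
  digitsAux-fromDigits {d ∷ []} (suc f) p@(msd d<g _) _ =
    trans (digitsAux-fromDigits-∷ [] f d<g (fromDigits-positive p)) (cong (d ∷_) (digitsAux-zero f))
  digitsAux-fromDigits {d ∷ ds} (suc f) p@(d<g ∷ q) (s≤s len≤f) =
    trans (digitsAux-fromDigits-∷ ds f d<g (fromDigits-positive p)) (cong (d ∷_) (digitsAux-fromDigits f q len≤f))

  module _ (2≤g : 2 ≤ g) where

    length≤fromDigits : ∀ {ds} → IsDigitString ds → length ds ≤ fromDigits ds
    length≤fromDigits p@(msd _ _)       = fromDigits-positive p
    length≤fromDigits {d ∷ ds} (_ ∷ p) = begin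
      suc (length ds)        ≤⟨ s≤s (length≤fromDigits p) ⟩
      suc (fromDigits ds)    ≤⟨ m<m*n (fromDigits ds) g {{>-nonZero (fromDigits-positive p)}} 2≤g ⟩
      fromDigits ds * g      ≤⟨ m≤n+m _ d ⟩
      d + fromDigits ds * g  ∎
      where open ≤-Reasoning

    digits-fromDigits : ∀ {ds} → IsDigitString ds → digits g (fromDigits ds) ≡ ds
    digits-fromDigits p = digitsAux-fromDigits _ p (length≤fromDigits p)

    map-digits-fromDigits : ∀ {m} {P : Vec (List ℕ) m} → All IsDigitString P →
                            map (digits g) (map fromDigits P) ≡ P
    map-digits-fromDigits []       = refl
    map-digits-fromDigits (p ∷ ps) = cong₂ _∷_ (digits-fromDigits p) (map-digits-fromDigits ps)

    digitsAux-isDigitString : ∀ f m → 1 ≤ m → m ≤ f → IsDigitString (digitsAux g f m)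
    digitsAux-isDigitString (suc f) (suc m) _ (s≤s m≤f) with suc m / g in quotient≡
    ... | zero  = subst (λ ds → IsDigitString (suc m % g ∷ ds)) (sym (digitsAux-zero f))
                    (msd (m%n<n (suc m) g) (subst (1 ≤_) (sym (m<n⇒m%n≡m (m/n≡0⇒m<n quotient≡))) (s≤s z≤n)))
    ... | suc q = m%n<n (suc m) g ∷ digitsAux-isDigitString f (suc q) (s≤s z≤n)
                    (≤-trans (s≤s⁻¹ (subst (_< suc m) quotient≡ (m/n<m (suc m) g 2≤g))) m≤f)

    digits-isDigitString : ∀ n → 1 ≤ n → IsDigitString (digits g n)
    digits-isDigitString n 1≤n = digitsAux-isDigitString n n 1≤n ≤-refl

  record Cut (t : ℕ) (ds : List ℕ) : Set where
    field
      prefix suffix        : List ℕ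
      ds≡prefix++suffix    : ds ≡ prefix ++ suffix
      prefix-isDigitString : IsDigitString prefix
      suffix-isDigitString : IsDigitString suffix
      excess               : ℕ
      excess≤g∸2           : excess ≤ g ∸ 2
      sum-prefix           : sumᴸ prefix ≡ t + excess

  cut : ∀ {ds} t → IsDigitString ds → 1 ≤ t → t + (g ∸ 2) < sumᴸ ds → Cut t ds
  cut t (msd {d} d<g _) 1≤t t+g∸2<d =
    ⊥-elim (<⇒≱ t+g∸2<d (≤-trans (≤-reflexive (+-identityʳ d)) (digit≤pos+[g∸2] d<g 1≤t)))
  cut {d ∷ ds} t (d<g ∷ p) 1≤t t+g∸2<sum with t ≤? d
  ... | yes t≤d = record
    { prefix               = [ d ]
    ; suffix               = ds
    ; ds≡prefix++suffix    = refl
    ; prefix-isDigitString = msd d<g (≤-trans 1≤t t≤d)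
    ; suffix-isDigitString = p
    ; excess               = d ∸ t
    ; excess≤g∸2           = m≤n+o⇒m∸n≤o d t (digit≤pos+[g∸2] d<g 1≤t)
    ; sum-prefix           = trans (+-identityʳ d) (sym (m+[n∸m]≡n t≤d))
    }
  ... | no t≰d = record
    { prefix               = d ∷ prefix
    ; suffix               = suffix
    ; ds≡prefix++suffix    = cong (d ∷_) ds≡prefix++suffix
    ; prefix-isDigitString = d<g ∷ prefix-isDigitString
    ; suffix-isDigitString = suffix-isDigitString
    ; excess               = excess
    ; excess≤g∸2           = excess≤g∸2
    ; sum-prefix           = begin
        d + sumᴸ prefix         ≡⟨ cong (d +_) sum-prefix ⟩
        d + (t ∸ d + excess)    ≡⟨ +-assoc d (t ∸ d) excess ⟨
        d + (t ∸ d) + excess    ≡⟨ cong (_+ excess) d+[t∸d]≡t ⟩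
        t + excess              ∎
    }
    where
    open ≡-Reasoning
    d+[t∸d]≡t : d + (t ∸ d) ≡ t
    d+[t∸d]≡t = m+[n∸m]≡n (<⇒≤ (≰⇒> t≰d))
    t∸d+g∸2<sum : t ∸ d + (g ∸ 2) < sumᴸ ds
    t∸d+g∸2<sum = +-cancelˡ-< d _ _
      (subst (_< d + sumᴸ ds) (trans (cong (_+ (g ∸ 2)) (sym d+[t∸d]≡t)) (+-assoc d (t ∸ d) (g ∸ 2))) t+g∸2<sum)
    open Cut (cut (t ∸ d) p (m<n⇒0<n∸m (≰⇒> t≰d)) t∸d+g∸2<sum)

  -- c is the overshoot accumulated by the pieces already cut off: ds falls short of the remaining targets by c.
  record Decomposition (k : ℕ) (s : Vec ℕ (suc k)) (ds : List ℕ) (c : ℕ) : Set where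
    field
      pieces               : Vec (List ℕ) (suc k)
      pieces-isDigitString : All IsDigitString pieces
      ds≡concat            : ds ≡ concat (toList pieces)
      sum-close            : ∀ i → ∣ sumᴸ (lookup pieces i) - lookup s i ∣ ≤ c + (g ∸ 2) * k

  decompose : ∀ k (s : Vec ℕ (suc k)) {ds} c → IsDigitString ds → All (1 ≤_) s →
              sumᴸ ds + c ≡ sum s → c + (g ∸ 2) * k < last s → Decomposition k s ds c
  decompose zero (s₀ ∷ []) {ds} c p _ sum≡ _ = record
    { pieces               = ds ∷ []
    ; pieces-isDigitString = p ∷ []
    ; ds≡concat            = sym (++-identityʳ ds)
    ; sum-close            = λ { zero → begin
        ∣ sumᴸ ds - s₀ ∣              ≡⟨ cong (λ y → ∣ sumᴸ ds - y ∣) (trans (sym (+-identityʳ s₀)) (sym sum≡)) ⟩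
        ∣ sumᴸ ds - sumᴸ ds + c ∣     ≡⟨ ∣m-m+n∣≡n (sumᴸ ds) c ⟩
        c                             ≤⟨ m≤m+n c _ ⟩
        c + (g ∸ 2) * 0               ∎ }
    }
    where open ≤-Reasoning
  decompose (suc k) (s₀ ∷ s) {ds} c p (1≤s₀ ∷ s-positive) sum≡ budget = record
    { pieces               = prefix ∷ pieces
    ; pieces-isDigitString = prefix-isDigitString ∷ pieces-isDigitString
    ; ds≡concat            = trans ds≡prefix++suffix (cong (prefix ++_) ds≡concat)
    ; sum-close            = λ
      { zero    → begin
          ∣ sumᴸ prefix - s₀ ∣       ≡⟨ cong (λ y → ∣ y - s₀ ∣) sum-prefix ⟩
          ∣ s₀ + excess - s₀ ∣       ≡⟨ trans (∣-∣-comm (s₀ + excess) s₀) (∣m-m+n∣≡n s₀ excess) ⟩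
          excess                     ≤⟨ ≤-trans (m≤n+m excess c) (m≤m+n _ _) ⟩
          c + excess + (g ∸ 2) * k   ≤⟨ budget-step ⟩
          c + (g ∸ 2) * suc k        ∎
      ; (suc i) → ≤-trans (sum-close i) budget-step }
    }
    where
    open ≤-Reasoning
    s₀+g∸2<sum : s₀ + (g ∸ 2) < sumᴸ ds
    s₀+g∸2<sum = +-cancelʳ-< c _ _ (begin-strict
      s₀ + (g ∸ 2) + c             ≡⟨ +-assoc s₀ (g ∸ 2) c ⟩
      s₀ + ((g ∸ 2) + c)           ≡⟨ cong (s₀ +_) (+-comm (g ∸ 2) c) ⟩
      s₀ + (c + (g ∸ 2))           ≤⟨ +-monoʳ-≤ s₀ (+-monoʳ-≤ c (m≤m*n (g ∸ 2) (suc k))) ⟩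
      s₀ + (c + (g ∸ 2) * suc k)   <⟨ +-monoʳ-< s₀ budget ⟩
      s₀ + last s                  ≤⟨ +-monoʳ-≤ s₀ (last≤sum s) ⟩
      s₀ + sum s                   ≡⟨ sum≡ ⟨
      sumᴸ ds + c                  ∎)
    open Cut (cut s₀ p 1≤s₀ s₀+g∸2<sum)
    budget-step : c + excess + (g ∸ 2) * k ≤ c + (g ∸ 2) * suc k
    budget-step = o≤n⇒m+o+n*k≤m+n*[1+k] c k excess≤g∸2
    sum-suffix≡ : sumᴸ suffix + (c + excess) ≡ sum s
    sum-suffix≡ = +-cancelˡ-≡ s₀ _ _ (trans (begin-equality
      s₀ + (sumᴸ suffix + (c + excess))     ≡⟨ m+[n+[o+p]]≡m+p+n+o s₀ (sumᴸ suffix) c excess ⟩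
      s₀ + excess + sumᴸ suffix + c         ≡⟨ cong (λ y → y + sumᴸ suffix + c) sum-prefix ⟨
      sumᴸ prefix + sumᴸ suffix + c         ≡⟨ cong (_+ c) (sum-++ prefix suffix) ⟨
      sumᴸ (prefix ++ suffix) + c           ≡⟨ cong (λ y → sumᴸ y + c) ds≡prefix++suffix ⟨
      sumᴸ ds + c                           ∎) sum≡)
    open Decomposition (decompose k s (c + excess) suffix-isDigitString s-positive sum-suffix≡
                         (≤-<-trans budget-step budget))

lemma1 : (g : ℕ) → .{{_ : NonZero g}} → 2 ≤ g →
         (n : ℕ) → 1 ≤ n →
         (k : ℕ) → (s : Vec ℕ (suc k)) → All (λ x → 1 ≤ x) s →
         digitSum g n ≡ sum s →
         (g ∸ 2) * k < last s →
         Σ (Vec ℕ (suc k)) (λ ns →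
           All (λ x → 1 ≤ x) ns ×
           digits g n ≡ concat (toList (map (digits g) ns)) ×
           ((i : Fin (suc k)) →
             ∣ digitSum g (lookup ns i) - lookup s i ∣ ≤ (g ∸ 2) * k))
lemma1 g 2≤g n 1≤n k s s-positive digitSum≡sum budget =
  map (fromDigits g) pieces ,
  map⁺ (All.map (fromDigits-positive g) pieces-isDigitString) ,
  trans ds≡concat (cong (λ P → concat (toList P)) (sym (map-digits-fromDigits g 2≤g pieces-isDigitString))) ,
  digitSum-close
  where
  open Decomposition (decompose g k s 0 (digits-isDigitString g 2≤g n 1≤n) s-positive
                        (trans (+-identityʳ _) digitSum≡sum) budget)
  digitSum-close : (i : Fin (suc k)) → ∣ digitSum g (lookup (map (fromDigits g) pieces) i) - lookup s i ∣ ≤ (g ∸ 2) * k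
  digitSum-close i rewrite lookup-map i (fromDigits g) pieces
                         | digits-fromDigits g 2≤g (lookup⁺ pieces-isDigitString i) = sum-close i
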